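{- Let $\mathcal{M}$ be an $n$-maniplex and $\omega\colon E(\mathcal{M})\to\mathbb{Z}_k$ a weight function such that $(\mathcal{M},\omega)$ is a proper pair. If $\mathcal{C}$ is an $\mathrm{Aut}(\mathcal{M})$-invariant $\ell$-colouring of $\mathcal{M}$, then $(2^{(\mathcal{M},\mathcal{C})},\omega_\mathcal{C})$ is a proper pair.
   Context: An $n$-maniplex is a connected $n$-valent simple graph with a proper edge-colouring by $\{0,\dots,n-1\}$ such that whenever $|i-j|>1$ the edges of colours $i,j$ form a disjoint union of $4$-cycles; vertices are flags, $u^i$ is the $i$-neighbour of $u$; automorphisms are colour-preserving graph automorphisms; it is regular if $\mathrm{Aut}(\mathcal{M})$ is transitive on flags; non-orientable if not bipartite. Facets are the components after deleting the edges of colour $n-1$. An $\ell$-colouring is a surjection $\mathcal{C}$ from facets to $\{1,\dots,\ell\}$ (flags get their facet's colour); it is $\mathrm{Aut}(\mathcal{M})$-invariant if for each $\varphi\in\mathrm{Aut}(\mathcal{M})$, $\mathcal{C}(F)\mapsto\mathcal{C}(F\varphi)$ is a well-defined bijection of colours. The colour-coded extension $2^{(\mathcal{M},\mathcal{C})}$ is the $(n+1)$-maniplex with flag set $\mathcal{F}\times\mathbb{Z}_2^\ell$, with $(u,x)^i=(u^i,x)$ for $i<n$ and $(u,x)^n=(u,x^j)$, $j$ the colour of $u$, $x^j$ differing from $x$ only in coordinate $j$. With $\sigma(x)=(-1)^{\#\{\text{coordinates }=1\}}$, the weight $\omega_\mathcal{C}$ assigns $\sigma(x)\omega(uu^i)$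 to the $i$-edge joining $(u,x),(u^i,x)$ for $i<n$, and $0$ to $n$-edges. For a weight $\omega\colon E(\Gamma)\to\mathbb{Z}_k$, the cross-cover $\Gamma^\omega$ has vertex set $V(\Gamma)\times\mathbb{Z}_k$ with $(u,i)$ adjacent to $(v,\omega(e)-i)$ for each edge $e=uv$, the new edge receiving the colour of $e$; $\pi(u,i)=u$. For a walk $W=(u_0,\dots,u_m)$ with edges $e_j$, $\omega(W)=\sum_j(-1)^j\omega(e_j)$. An automorphism $\varphi$ of $\mathcal{M}$ lifts if there is an automorphism $\bar\varphi$ of $\mathcal{M}^\omega$ with $\pi(y\bar\varphi)=\pi(y)\varphi$; $\omega$ is $\mathrm{Aut}(\mathcal{M})$-consistent if every automorphism lifts. $(\mathcal{M},\omega)$ is a proper pair if (1) $\mathcal{M}$ is regular, (2) $\mathcal{M}$ has a closed walk $W$ of odd length with $\omega(W)$ even, (3) $\mathcal{M}^\omega$ is a non-orientable maniplex, (4) $\omega$ is $\mathrm{Aut}(\mathcal{M})$-consistent. -}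

module Defs where

open import Data.Nat using (ℕ; zero; suc; _+_; _∸_; _<_; _%_; _≡ᵇ_; NonZero)
open import Data.Nat.DivMod using (_mod_)
open import Data.Fin using (Fin; toℕ)
open import Data.Fin.Properties using ()
open import Data.Bool using (Bool; true; false; not; if_then_else_)
open import Data.Vec using (Vec; updateAt; countᵇ)
open import Data.List using (List; []; _∷_; length)
open import Data.Product using (Σ; _×_; _,_; proj₁; proj₂; ∃; ∃-syntax)
open import Data.Sum using (_⊎_)
open import Function using (_∘_; id)
open import Function.Bundles using (_↔_; Inverse)
open import Relation.Binary.PropositionalEquality using (_≡_; _≢_)
open import Relation.Nullary using (¬_)

module _ {k : ℕ} .{{_ : NonZero k}} where
  _+ₖ_ : Fin k → Fin k → Fin k
  a +ₖ b = (toℕ a + toℕ b) mod k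

  -ₖ_ : Fin k → Fin k
  -ₖ a = (k ∸ toℕ a) mod k

  _-ₖ_ : Fin k → Fin k → Fin k
  a -ₖ b = a +ₖ (-ₖ b)

  0ₖ : Fin k
  0ₖ = 0 mod k

  EvenZ : Fin k → Set
  EvenZ x = Σ (Fin k) λ b → b +ₖ b ≡ x

-- Edge-coloured n-valent graphs given by their colour-i neighbour maps
-- (u ↦ u^i).  Flags = vertices.

record Pregraph (n : ℕ) : Set₁ where
  field
    Flag : Set
    r    : Fin n → Flag → Flag

open Pregraph public

-- walks are given by a start flag and the sequence of colours used
walkEnd : ∀ {n} (M : Pregraph n) → Flag M → List (Fin n) → Flag M
walkEnd M u []       = u
walkEnd M u (i ∷ is) = walkEnd M (r M i u) is

Far : ∀ {n} → Fin n → Fin n → Set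
Far i j = (suc (toℕ i) < toℕ j) ⊎ (suc (toℕ j) < toℕ i)

record IsManiplex {n : ℕ} (M : Pregraph n) : Set where
  field
    invol     : ∀ i u → r M i (r M i u) ≡ u
    noLoop    : ∀ i u → r M i u ≢ u
    simple    : ∀ i j u → i ≢ j → r M i u ≢ r M j u
    fourCycle : ∀ i j u → Far i j → r M i (r M j u) ≡ r M j (r M i u)
    connected : ∀ u v → Σ (List (Fin n)) λ w → walkEnd M u w ≡ v

record Automorphism {n : ℕ} (M : Pregraph n) : Set where
  field
    bij      : Flag M ↔ Flag M
    preserve : ∀ i u → Inverse.to bij (r M i u) ≡ r M i (Inverse.to bij u)

  act : Flag M → Flag M
  act = Inverse.to bij

open Automorphism public using (act)

Regular : ∀ {n} (M : Pregraph n) → Set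
Regular M = ∀ u v → Σ (Automorphism M) λ φ → act φ u ≡ v

Bipartite : ∀ {n} (M : Pregraph n) → Set
Bipartite M = Σ (Flag M → Bool) λ c → ∀ i u → c (r M i u) ≡ not (c u)

NonOrientable : ∀ {n} (M : Pregraph n) → Set
NonOrientable M = ¬ Bipartite M

-- Weight functions ω : E(M) → Z_k.  ω i u is the weight of the i-edge
-- {u, u^i}; it must not depend on the chosen endpoint.

IsWeight : ∀ {n k} (M : Pregraph n) → (Fin n → Flag M → Fin k) → Set
IsWeight M ω = ∀ i u → ω i (r M i u) ≡ ω i u

-- ω(W) = Σ_j (-1)^j ω(e_j)
walkWeight : ∀ {n k} .{{_ : NonZero k}} (M : Pregraph n)
           → (Fin n → Flag M → Fin k) → Flag M → List (Fin n) → Fin k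
walkWeight M ω u []       = 0ₖ
walkWeight M ω u (i ∷ is) = ω i u -ₖ walkWeight M ω (r M i u) is

crossCover : ∀ {n k} .{{_ : NonZero k}} (M : Pregraph n)
           → (Fin n → Flag M → Fin k) → Pregraph n
crossCover {n} {k} M ω = record
  { Flag = Flag M × Fin k
  ; r    = λ i ua → r M i (proj₁ ua) , (ω i (proj₁ ua) -ₖ proj₂ ua)
  }

Lifts : ∀ {n k} .{{_ : NonZero k}} (M : Pregraph n)
      (ω : Fin n → Flag M → Fin k) → Automorphism M → Set
Lifts M ω φ = Σ (Automorphism (crossCover M ω)) λ ψ →
                ∀ y → proj₁ (act ψ y) ≡ act φ (proj₁ y)

Consistent : ∀ {n k} .{{_ : NonZero k}} (M : Pregraph n)
           → (Fin n → Flag M → Fin k) → Set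
Consistent M ω = ∀ (φ : Automorphism M) → Lifts M ω φ

record ProperPair {n k : ℕ} .{{_ : NonZero k}} (M : Pregraph n)
                  (ω : Fin n → Flag M → Fin k) : Set where
  field
    maniplex      : IsManiplex M
    regular       : Regular M
    oddEvenWalk   : Σ (Flag M) λ u → Σ (List (Fin n)) λ W →
                      (walkEnd M u W ≡ u) × (length W % 2 ≡ 1)
                      × EvenZ (walkWeight M ω u W)
    coverManiplex : IsManiplex (crossCover M ω)
    coverNonOrient : NonOrientable (crossCover M ω)
    consistent    : Consistent M ω

-- ℓ-colourings of facets.  A function on facets (components after
-- deleting the (n-1)-edges) is a function on flags that is constant
-- along every i-edge with i < n-1.

record Colouring {n : ℕ} (M : Pregraph n) (ℓ : ℕ) : Set where
  field
    col       : Flag M → Fin ℓ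
    onFacets  : ∀ (i : Fin n) u → suc (toℕ i) < n → col (r M i u) ≡ col u
    surjective : ∀ (c : Fin ℓ) → Σ (Flag M) λ u → col u ≡ c

open Colouring public

AutInvariant : ∀ {n ℓ} (M : Pregraph n) → Colouring M ℓ → Set
AutInvariant {ℓ = ℓ} M C =
  ∀ (φ : Automorphism M) → Σ (Fin ℓ ↔ Fin ℓ) λ π →
    ∀ u → col C (act φ u) ≡ Inverse.to π (col C u)

snoc : ∀ {n} {A : Set} → (Fin n → A) → A → Fin (suc n) → A
snoc {zero}  f a Fin.zero    = a
snoc {suc n} f a Fin.zero    = f Fin.zero
snoc {suc n} f a (Fin.suc i) = snoc {n} (f ∘ Fin.suc) a i

flipAt : ∀ {ℓ} → Vec Bool ℓ → Fin ℓ → Vec Bool ℓ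
flipAt x j = updateAt x j not

colourCoded : ∀ {n ℓ} (M : Pregraph n) → Colouring M ℓ → Pregraph (suc n)
colourCoded {n} {ℓ} M C = record
  { Flag = Flag M × Vec Bool ℓ
  ; r    = λ i ux → snoc {n} (λ j → r M j (proj₁ ux) , proj₂ ux)
                         (proj₁ ux , flipAt (proj₂ ux) (col C (proj₁ ux))) i
  }

signAct : ∀ {ℓ k} .{{_ : NonZero k}} → Vec Bool ℓ → Fin k → Fin k
signAct x a = if (countᵇ id x % 2 ≡ᵇ 0) then a else -ₖ a

colourCodedWeight : ∀ {n ℓ k} .{{_ : NonZero k}} (M : Pregraph n)
  (C : Colouring M ℓ) → (Fin n → Flag M → Fin k)
  → Fin (suc n) → Flag (colourCoded M C) → Fin k
colourCodedWeight {n} M C ω i ux =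
  snoc {n} (λ j → signAct (proj₂ ux) (ω j (proj₁ ux))) 0ₖ i

{-# OPTIONS --safe #-}

-- Let E = 2^(M,C) and ωᴱ = ω_C. Multiplying the Z_k-coordinate of a flag by σ(x) identifies the
-- cross-cover E^ωᴱ with the colour-coded extension of M^ω (coloured through the projection to M),
-- so E^ωᴱ is a maniplex, and a 2-colouring of it would restrict to one of M^ω in the layer x = 0.
-- Every automorphism φ of M, with the colour permutation π it induces, gives automorphisms
-- (u, x) ↦ (uφ, x^π + z) of E; these act transitively, so by connectedness every automorphism of E
-- is one of them, and each lifts to E^ωᴱ because φ lifts to M^ω. An odd closed walk of even weight
-- in M stays one in the layer x = 0 of E.
module Submission where

open import Defs
open import Level using (0ℓ)
open import Data.Nat using (ℕ; zero; suc; _+_; _∸_; _<_; _%_; _≡ᵇ_; NonZero; >-nonZero⁻¹)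
open import Data.Nat.Properties using (+-comm; +-assoc; m+[n∸m]≡n; <⇒≤; <-irrefl; <-trans; n<1+n; <-asym)
open import Data.Nat.DivMod using (_mod_; m%n<n; %-distribˡ-+; m%n%n≡m%n; m<n⇒m%n≡m; n%n≡0)
open import Data.Fin using (Fin; zero; suc; toℕ; inject₁; fromℕ; _≟_)
open import Data.Fin.Properties using (toℕ-fromℕ<; toℕ-injective; toℕ<n; toℕ-inject₁; toℕ-fromℕ)
open import Data.Fin.Relation.Unary.Top using (view; ‵fromℕ; ‵inject₁)
open import Data.Bool using (Bool; true; false; not; _xor_; if_then_else_)
open import Data.Bool.Properties using (not-involutive; not-distribˡ-xor; xor-assoc; xor-same; xor-identityʳ)
open import Data.Vec using (Vec; []; _∷_; lookup; tabulate; zipWith; replicate; countᵇ)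
open import Data.Vec.Properties using (∷-injectiveʳ; lookup∘tabulate; tabulate∘lookup; tabulate-cong; lookup∘updateAt; lookup∘updateAt′)
open import Data.List using (List; []; _∷_; _++_; map; length)
open import Data.List.Properties using (length-map)
open import Data.Product using (Σ; _×_; _,_; proj₁; proj₂)
import Data.Product as Product
open import Data.Sum using (_⊎_; inj₁; inj₂; swap)
open import Function using (_∘_; id)
open import Function.Bundles using (_↔_; Inverse; mk↔ₛ′)
open Inverse using (to; from; strictlyInverseˡ; strictlyInverseʳ)
open import Function.Construct.Composition using (_↔-∘_)
open import Function.Construct.Symmetry using (↔-sym)
open import Relation.Binary.Definitions using (Reflexive; Transitive)
open import Relation.Binary.PropositionalEquality
open import Relation.Nullary using (¬_; yes; no; contradiction)
open import Algebra.Bundles using (AbelianGroup)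
open import Algebra.Structures using (IsAbelianGroup)
import Algebra.Properties.AbelianGroup as AbelianGroupProperties
import Algebra.Properties.Group as GroupProperties

-- Z_k

module _ {k : ℕ} .{{_ : NonZero k}} where

  private
    toℕ-mod : ∀ m → toℕ (m mod k) ≡ m % k
    toℕ-mod m = toℕ-fromℕ< (m%n<n m k)

    %-absorbˡ : ∀ m n → (m % k + n) % k ≡ (m + n) % k
    %-absorbˡ m n = begin
      (m % k + n) % k           ≡⟨ %-distribˡ-+ (m % k) n k ⟩
      (m % k % k + n % k) % k   ≡⟨ cong (λ v → (v + n % k) % k) (m%n%n≡m%n m k) ⟩
      (m % k + n % k) % k       ≡⟨ %-distribˡ-+ m n k ⟨
      (m + n) % k               ∎
      where open ≡-Reasoning

    %-absorbʳ : ∀ m n → (m + n % k) % k ≡ (m + n) % k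
    %-absorbʳ m n = begin
      (m + n % k) % k   ≡⟨ cong (_% k) (+-comm m (n % k)) ⟩
      (n % k + m) % k   ≡⟨ %-absorbˡ n m ⟩
      (n + m) % k       ≡⟨ cong (_% k) (+-comm n m) ⟩
      (m + n) % k       ∎
      where open ≡-Reasoning

    toℕ-0ₖ : toℕ (0ₖ {k}) ≡ 0
    toℕ-0ₖ = trans (toℕ-mod 0) (m<n⇒m%n≡m (>-nonZero⁻¹ k))

  +ₖ-assoc : ∀ (a b c : Fin k) → (a +ₖ b) +ₖ c ≡ a +ₖ (b +ₖ c)
  +ₖ-assoc a b c = toℕ-injective (begin
    toℕ ((a +ₖ b) +ₖ c)                  ≡⟨ toℕ-mod _ ⟩
    (toℕ (a +ₖ b) + toℕ c) % k           ≡⟨ cong (λ v → (v + toℕ c) % k) (toℕ-mod _) ⟩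
    ((toℕ a + toℕ b) % k + toℕ c) % k    ≡⟨ %-absorbˡ (toℕ a + toℕ b) (toℕ c) ⟩
    (toℕ a + toℕ b + toℕ c) % k          ≡⟨ cong (_% k) (+-assoc (toℕ a) (toℕ b) (toℕ c)) ⟩
    (toℕ a + (toℕ b + toℕ c)) % k        ≡⟨ %-absorbʳ (toℕ a) (toℕ b + toℕ c) ⟨
    (toℕ a + (toℕ b + toℕ c) % k) % k    ≡⟨ cong (λ v → (toℕ a + v) % k) (toℕ-mod _) ⟨
    (toℕ a + toℕ (b +ₖ c)) % k           ≡⟨ toℕ-mod _ ⟨
    toℕ (a +ₖ (b +ₖ c))                  ∎)
    where open ≡-Reasoning

  +ₖ-comm : ∀ (a b : Fin k) → a +ₖ b ≡ b +ₖ a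
  +ₖ-comm a b = cong (_mod k) (+-comm (toℕ a) (toℕ b))

  +ₖ-identityˡ : ∀ (a : Fin k) → 0ₖ +ₖ a ≡ a
  +ₖ-identityˡ a = toℕ-injective (begin
    toℕ (0ₖ +ₖ a)            ≡⟨ toℕ-mod _ ⟩
    (toℕ (0ₖ {k}) + toℕ a) % k ≡⟨ cong (λ v → (v + toℕ a) % k) toℕ-0ₖ ⟩
    toℕ a % k                ≡⟨ m<n⇒m%n≡m (toℕ<n a) ⟩
    toℕ a                    ∎)
    where open ≡-Reasoning

  +ₖ-inverseʳ : ∀ (a : Fin k) → a +ₖ (-ₖ a) ≡ 0ₖ
  +ₖ-inverseʳ a = toℕ-injective (begin
    toℕ (a +ₖ (-ₖ a))                ≡⟨ toℕ-mod _ ⟩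
    (toℕ a + toℕ (-ₖ a)) % k         ≡⟨ cong (λ v → (toℕ a + v) % k) (toℕ-mod _) ⟩
    (toℕ a + (k ∸ toℕ a) % k) % k    ≡⟨ %-absorbʳ (toℕ a) (k ∸ toℕ a) ⟩
    (toℕ a + (k ∸ toℕ a)) % k        ≡⟨ cong (_% k) (m+[n∸m]≡n (<⇒≤ (toℕ<n a))) ⟩
    k % k                            ≡⟨ n%n≡0 k ⟩
    0                                ≡⟨ toℕ-0ₖ ⟨
    toℕ (0ₖ {k})                     ∎)
    where open ≡-Reasoning

  +ₖ-isAbelianGroup : IsAbelianGroup _≡_ _+ₖ_ 0ₖ (λ a → -ₖ a)
  +ₖ-isAbelianGroup = record
    { isGroup = record
      { isMonoid = record
        { isSemigroup = record
          { isMagma = record { isEquivalence = isEquivalence ; ∙-cong = cong₂ _+ₖ_ }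
          ; assoc = +ₖ-assoc
          }
        ; identity = +ₖ-identityˡ , λ a → trans (+ₖ-comm a 0ₖ) (+ₖ-identityˡ a)
        }
      ; inverse = (λ a → trans (+ₖ-comm (-ₖ a) a) (+ₖ-inverseʳ a)) , +ₖ-inverseʳ
      ; ⁻¹-cong = cong (λ a → -ₖ a)
      }
    ; comm = +ₖ-comm
    }

  +ₖ-abelianGroup : AbelianGroup 0ℓ 0ℓ
  +ₖ-abelianGroup = record { isAbelianGroup = +ₖ-isAbelianGroup }

  open GroupProperties (AbelianGroup.group +ₖ-abelianGroup) using (⁻¹-involutive; ε⁻¹≈ε)
  open AbelianGroupProperties +ₖ-abelianGroup using (⁻¹-∙-comm)

  sign : Bool → Fin k → Fin k
  sign b a = if b then a else -ₖ a

  sign-involutive : ∀ b a → sign b (sign b a) ≡ a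
  sign-involutive true  a = refl
  sign-involutive false a = ⁻¹-involutive a

  sign-0ₖ : ∀ b → sign b 0ₖ ≡ 0ₖ
  sign-0ₖ true  = refl
  sign-0ₖ false = ε⁻¹≈ε

  sign-distrib-ₖ : ∀ b a c → sign b (a -ₖ c) ≡ sign b a -ₖ sign b c
  sign-distrib-ₖ true  a c = refl
  sign-distrib-ₖ false a c = sym (⁻¹-∙-comm a (-ₖ c))

  sign-not : ∀ b a → sign (not b) a ≡ 0ₖ -ₖ sign b a
  sign-not true  a = sym (+ₖ-identityˡ (-ₖ a))
  sign-not false a = sym (trans (+ₖ-identityˡ (-ₖ -ₖ a)) (⁻¹-involutive a))

-- Bit vectors

private
  variable
    ℓ n : ℕ

flipAt-involutive : ∀ (x : Vec Bool ℓ) d → flipAt (flipAt x d) d ≡ x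
flipAt-involutive (a ∷ x) zero    = cong (_∷ x) (not-involutive a)
flipAt-involutive (a ∷ x) (suc d) = cong (a ∷_) (flipAt-involutive x d)

flipAt-≢ : ∀ (x : Vec Bool ℓ) d → flipAt x d ≢ x
flipAt-≢ (true  ∷ x) zero    ()
flipAt-≢ (false ∷ x) zero    ()
flipAt-≢ (a ∷ x)     (suc d) eq = flipAt-≢ x d (∷-injectiveʳ eq)

flipAt-closure-total : (R : Vec Bool ℓ → Vec Bool ℓ → Set) → Reflexive R → Transitive R
                     → (∀ x d → R x (flipAt x d)) → ∀ x y → R x y
flipAt-closure-total R refl′ trans′ step []      []      = refl′
flipAt-closure-total R refl′ trans′ step (a ∷ x) (b ∷ y) = trans′ tails heads
  where
  tails : R (a ∷ x) (a ∷ y)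
  tails = flipAt-closure-total (λ x y → R (a ∷ x) (a ∷ y)) refl′ trans′ (λ x d → step (a ∷ x) (suc d)) x y
  heads : ∀ {a b} → R (a ∷ y) (b ∷ y)
  heads {true}  {true}  = refl′
  heads {false} {false} = refl′
  heads {true}  {false} = step (true ∷ y) zero
  heads {false} {true}  = step (false ∷ y) zero

-- signAct x is definitionally sign (evenᵇ x), the paper's σ(x).
evenᵇ : Vec Bool ℓ → Bool
evenᵇ x = countᵇ id x % 2 ≡ᵇ 0

private
  even-suc : ∀ m → (suc m % 2 ≡ᵇ 0) ≡ not (m % 2 ≡ᵇ 0)
  even-suc zero          = refl
  even-suc (suc zero)    = refl
  even-suc (suc (suc m)) = even-suc m

evenᵇ-flipAt : ∀ (x : Vec Bool ℓ) d → evenᵇ (flipAt x d) ≡ not (evenᵇ x)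
evenᵇ-flipAt (true  ∷ x) zero    = trans (sym (not-involutive _)) (cong not (sym (even-suc (countᵇ id x))))
evenᵇ-flipAt (false ∷ x) zero    = even-suc (countᵇ id x)
evenᵇ-flipAt (true  ∷ x) (suc d) = begin
  evenᵇ (true ∷ flipAt x d)  ≡⟨ even-suc (countᵇ id (flipAt x d)) ⟩
  not (evenᵇ (flipAt x d))   ≡⟨ cong not (evenᵇ-flipAt x d) ⟩
  not (not (evenᵇ x))        ≡⟨ cong not (even-suc (countᵇ id x)) ⟨
  not (evenᵇ (true ∷ x))     ∎
  where open ≡-Reasoning
evenᵇ-flipAt (false ∷ x) (suc d) = evenᵇ-flipAt x d

evenᵇ-replicate-false : evenᵇ (replicate ℓ false) ≡ true
evenᵇ-replicate-false {zero}  = refl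
evenᵇ-replicate-false {suc ℓ} = evenᵇ-replicate-false {ℓ}

private
  lookup-ext : ∀ {A : Set} {x y : Vec A ℓ} → (∀ i → lookup x i ≡ lookup y i) → x ≡ y
  lookup-ext {x = x} {y} eq = trans (sym (tabulate∘lookup x)) (trans (tabulate-cong eq) (tabulate∘lookup y))

reindex : ∀ {A : Set} {m} → (Fin m → Fin ℓ) → Vec A ℓ → Vec A m
reindex f x = tabulate (lookup x ∘ f)

reindex-inverse : ∀ {A : Set} {f g : Fin ℓ → Fin ℓ} → (∀ i → g (f i) ≡ i)
                → (x : Vec A ℓ) → reindex f (reindex g x) ≡ x
reindex-inverse {f = f} {g} gf x = lookup-ext λ i → begin
  lookup (reindex f (reindex g x)) i ≡⟨ lookup∘tabulate _ i ⟩
  lookup (reindex g x) (f i)         ≡⟨ lookup∘tabulate _ (f i) ⟩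
  lookup x (g (f i))                 ≡⟨ cong (lookup x) (gf i) ⟩
  lookup x i                         ∎
  where open ≡-Reasoning

relabel : ∀ {A : Set} → Fin ℓ ↔ Fin ℓ → Vec A ℓ ↔ Vec A ℓ
relabel π = mk↔ₛ′ (reindex (from π)) (reindex (to π))
  (reindex-inverse (strictlyInverseˡ π)) (reindex-inverse (strictlyInverseʳ π))

relabel-flipAt : ∀ (π : Fin ℓ ↔ Fin ℓ) x d → to (relabel π) (flipAt x d) ≡ flipAt (to (relabel π) x) (to π d)
relabel-flipAt π x d = lookup-ext pointwise
  where
  x′ = to (relabel π) x
  pointwise : ∀ e → lookup (to (relabel π) (flipAt x d)) e ≡ lookup (flipAt x′ (to π d)) e
  pointwise e with e ≟ to π d
  ... | yes refl = begin
    lookup (to (relabel π) (flipAt x d)) (to π d) ≡⟨ lookup∘tabulate _ (to π d) ⟩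
    lookup (flipAt x d) (from π (to π d))         ≡⟨ cong (lookup (flipAt x d)) (strictlyInverseʳ π d) ⟩
    lookup (flipAt x d) d                         ≡⟨ lookup∘updateAt d x ⟩
    not (lookup x d)                              ≡⟨ cong (not ∘ lookup x) (strictlyInverseʳ π d) ⟨
    not (lookup x (from π (to π d)))              ≡⟨ cong not (lookup∘tabulate _ (to π d)) ⟨
    not (lookup x′ (to π d))                      ≡⟨ lookup∘updateAt (to π d) x′ ⟨
    lookup (flipAt x′ (to π d)) (to π d)          ∎
    where open ≡-Reasoning
  ... | no e≢πd = begin
    lookup (to (relabel π) (flipAt x d)) e ≡⟨ lookup∘tabulate _ e ⟩
    lookup (flipAt x d) (from π e)         ≡⟨ lookup∘updateAt′ (from π e) d π⁻¹e≢d x ⟩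
    lookup x (from π e)                    ≡⟨ lookup∘tabulate _ e ⟨
    lookup x′ e                            ≡⟨ lookup∘updateAt′ e (to π d) e≢πd x′ ⟨
    lookup (flipAt x′ (to π d)) e          ∎
    where
    open ≡-Reasoning
    π⁻¹e≢d : from π e ≢ d
    π⁻¹e≢d eq = e≢πd (trans (sym (strictlyInverseˡ π e)) (cong (to π) eq))

_⊕_ : Vec Bool ℓ → Vec Bool ℓ → Vec Bool ℓ
_⊕_ = zipWith _xor_

flipAt-⊕ : ∀ (x z : Vec Bool ℓ) d → flipAt x d ⊕ z ≡ flipAt (x ⊕ z) d
flipAt-⊕ (a ∷ x) (b ∷ z) zero    = cong (_∷ (x ⊕ z)) (sym (not-distribˡ-xor a b))
flipAt-⊕ (a ∷ x) (b ∷ z) (suc d) = cong ((a xor b) ∷_) (flipAt-⊕ x z d)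

⊕-cancelʳ : ∀ (x z : Vec Bool ℓ) → (x ⊕ z) ⊕ z ≡ x
⊕-cancelʳ []      []      = refl
⊕-cancelʳ (a ∷ x) (b ∷ z) = cong₂ _∷_ xor-cancelʳ (⊕-cancelʳ x z)
  where
  xor-cancelʳ : (a xor b) xor b ≡ a
  xor-cancelʳ = trans (xor-assoc a b b) (trans (cong (a xor_) (xor-same b)) (xor-identityʳ a))

⊕-cancelˡ : ∀ (x y : Vec Bool ℓ) → x ⊕ (x ⊕ y) ≡ y
⊕-cancelˡ []      []      = refl
⊕-cancelˡ (a ∷ x) (b ∷ y) = cong₂ _∷_ xor-cancelˡ (⊕-cancelˡ x y)
  where
  xor-cancelˡ : a xor (a xor b) ≡ b
  xor-cancelˡ = trans (sym (xor-assoc a a b)) (cong (_xor b) (xor-same a))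

translate : Vec Bool ℓ → Vec Bool ℓ ↔ Vec Bool ℓ
translate z = mk↔ₛ′ (_⊕ z) (_⊕ z) (λ x → ⊕-cancelʳ x z) (λ x → ⊕-cancelʳ x z)

affine : Fin ℓ ↔ Fin ℓ → Vec Bool ℓ → Vec Bool ℓ ↔ Vec Bool ℓ
affine π z = translate z ↔-∘ relabel π

affine-flipAt : ∀ (π : Fin ℓ ↔ Fin ℓ) z x d → to (affine π z) (flipAt x d) ≡ flipAt (to (affine π z) x) (to π d)
affine-flipAt π z x d = trans (cong (_⊕ z) (relabel-flipAt π x d)) (flipAt-⊕ (to (relabel π) x) z (to π d))

affine-transitive : ∀ (π : Fin ℓ ↔ Fin ℓ) x y → Σ (Vec Bool ℓ) λ z → to (affine π z) x ≡ y
affine-transitive π x y = to (relabel π) x ⊕ y , ⊕-cancelˡ (to (relabel π) x) y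

-- Walks and homomorphisms

walkEnd-++ : ∀ (A : Pregraph n) p v w → walkEnd A p (v ++ w) ≡ walkEnd A (walkEnd A p v) w
walkEnd-++ A p []      w = refl
walkEnd-++ A p (i ∷ v) w = walkEnd-++ A (r A i p) v w

Reachable : (A : Pregraph n) → Flag A → Flag A → Set
Reachable {n} A p q = Σ (List (Fin n)) λ w → walkEnd A p w ≡ q

Connected : Pregraph n → Set
Connected A = ∀ p q → Reachable A p q

module _ {A : Pregraph n} where

  reachable-refl : Reflexive (Reachable A)
  reachable-refl = [] , refl

  reachable-trans : Transitive (Reachable A)
  reachable-trans {p} (v , refl) (w , refl) = v ++ w , walkEnd-++ A p v w

  reachable-step : ∀ i p → Reachable A p (r A i p)
  reachable-step i p = i ∷ [] , refl

IsHomomorphism : (A B : Pregraph n) → (Flag A → Flag B) → Set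
IsHomomorphism A B f = ∀ i a → f (r A i a) ≡ r B i (f a)

walkEnd-homomorphism : ∀ {A B : Pregraph n} {f : Flag A → Flag B} → IsHomomorphism A B f
                     → ∀ a w → f (walkEnd A a w) ≡ walkEnd B (f a) w
walkEnd-homomorphism hom a []      = refl
walkEnd-homomorphism {A = A} {B} hom a (i ∷ w) =
  trans (walkEnd-homomorphism hom (r A i a) w) (cong (λ b → walkEnd B b w) (hom i a))

homomorphisms-agree : ∀ {A B : Pregraph n} {f g : Flag A → Flag B} → Connected A
                    → IsHomomorphism A B f → IsHomomorphism A B g
                    → ∀ {p} → f p ≡ g p → ∀ q → f q ≡ g q
homomorphisms-agree {A = A} {B} {f} {g} conn homf homg {p} eq q with conn p q
... | w , refl = begin
  f (walkEnd A p w) ≡⟨ walkEnd-homomorphism homf p w ⟩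
  walkEnd B (f p) w ≡⟨ cong (λ b → walkEnd B b w) eq ⟩
  walkEnd B (g p) w ≡⟨ walkEnd-homomorphism homg p w ⟨
  g (walkEnd A p w) ∎
  where open ≡-Reasoning

record Isomorphism (A B : Pregraph n) : Set where
  field
    bij         : Flag A ↔ Flag B
    homomorphic : IsHomomorphism A B (to bij)

module _ {A B : Pregraph n} (I : Isomorphism A B) where

  open Isomorphism I

  private
    from-injective : ∀ {b c} → from bij b ≡ from bij c → b ≡ c
    from-injective {b} {c} eq = trans (sym (strictlyInverseˡ bij b)) (trans (cong (to bij) eq) (strictlyInverseˡ bij c))

  from-homomorphic : IsHomomorphism B A (from bij)
  from-homomorphic i b = begin
    from bij (r B i b)                    ≡⟨ cong (from bij ∘ r B i) (strictlyInverseˡ bij b) ⟨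
    from bij (r B i (to bij (from bij b))) ≡⟨ cong (from bij) (homomorphic i (from bij b)) ⟨
    from bij (to bij (r A i (from bij b))) ≡⟨ strictlyInverseʳ bij _ ⟩
    r A i (from bij b)                    ∎
    where open ≡-Reasoning

  isManiplex-transport : IsManiplex A → IsManiplex B
  isManiplex-transport MA = record
    { invol     = λ i b → from-injective (trans (from-r² i i b) (invol i (from bij b)))
    ; noLoop    = λ i b eq → noLoop i (from bij b) (trans (sym (from-homomorphic i b)) (cong (from bij) eq))
    ; simple    = λ i j b i≢j eq → simple i j (from bij b) i≢j
                    (trans (sym (from-homomorphic i b)) (trans (cong (from bij) eq) (from-homomorphic j b)))
    ; fourCycle = λ i j b far → from-injective
                    (trans (from-r² i j b) (trans (fourCycle i j (from bij b) far) (sym (from-r² j i b))))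
    ; connected = λ b c → let (w , eq) = connected (from bij b) (from bij c) in
                    w , from-injective (trans (walkEnd-homomorphism from-homomorphic b w) eq)
    }
    where
    open IsManiplex MA
    from-r² : ∀ i j b → from bij (r B i (r B j b)) ≡ r A i (r A j (from bij b))
    from-r² i j b = trans (from-homomorphic i _) (cong (r A i) (from-homomorphic j b))

  bipartite-reflect : Bipartite B → Bipartite A
  bipartite-reflect (c , alternates) = c ∘ to bij , λ i a → trans (cong c (homomorphic i a)) (alternates i (to bij a))

  conjugate : Automorphism A → Automorphism B
  conjugate φ = record
    { bij      = bij ↔-∘ (Automorphism.bij φ ↔-∘ ↔-sym bij)
    ; preserve = λ i b → trans (cong (to bij ∘ act φ) (from-homomorphic i b))
                     (trans (cong (to bij) (Automorphism.preserve φ i _)) (homomorphic i _))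
    }

-- The colour-coded extension

snoc-inject₁ : ∀ {A : Set} (f : Fin n → A) a j → snoc f a (inject₁ j) ≡ f j
snoc-inject₁ f a zero    = refl
snoc-inject₁ f a (suc j) = snoc-inject₁ (f ∘ suc) a j

snoc-fromℕ : ∀ {A : Set} (f : Fin n → A) a → snoc f a (fromℕ n) ≡ a
snoc-fromℕ {zero}  f a = refl
snoc-fromℕ {suc n} f a = snoc-fromℕ (f ∘ suc) a

private
  FarAt : ℕ → ℕ → Set
  FarAt a b = (suc a < b) ⊎ (suc b < a)

Far-inject₁ : ∀ (i j : Fin n) → Far (inject₁ i) (inject₁ j) → Far i j
Far-inject₁ i j = subst₂ FarAt (toℕ-inject₁ i) (toℕ-inject₁ j)

Far-inject₁-fromℕ : ∀ (j : Fin n) → Far (inject₁ j) (fromℕ n) → suc (toℕ j) < n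
Far-inject₁-fromℕ {n} j far with subst₂ FarAt (toℕ-inject₁ j) (toℕ-fromℕ n) far
... | inj₁ j+1<n = j+1<n
... | inj₂ n+1<j = contradiction (<-trans (n<1+n n) n+1<j) (<-asym (toℕ<n j))

¬Far-refl : ∀ (i : Fin n) → ¬ Far i i
¬Far-refl i (inj₁ far) = <-irrefl refl (<-trans (n<1+n _) far)
¬Far-refl i (inj₂ far) = <-irrefl refl (<-trans (n<1+n _) far)

module _ (M : Pregraph n) (C : Colouring M ℓ) where

  private
    E = colourCoded M C

  r-inject₁ : ∀ j u x → r E (inject₁ j) (u , x) ≡ (r M j u , x)
  r-inject₁ j u x = snoc-inject₁ (λ j → r M j u , x) _ j

  r-fromℕ : ∀ u x → r E (fromℕ n) (u , x) ≡ (u , flipAt x (col C u))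
  r-fromℕ u x = snoc-fromℕ (λ j → r M j u , x) _

  walkEnd-layer : ∀ u x w → walkEnd E (u , x) (map inject₁ w) ≡ (walkEnd M u w , x)
  walkEnd-layer u x []      = refl
  walkEnd-layer u x (j ∷ w) =
    trans (cong (λ p → walkEnd E p (map inject₁ w)) (r-inject₁ j u x)) (walkEnd-layer (r M j u) x w)

  reachable-layer : ∀ {u v} x → Reachable M u v → Reachable E (u , x) (v , x)
  reachable-layer {u} x (w , refl) = map inject₁ w , walkEnd-layer u x w

  reachable-flipAt : Connected M → ∀ u x d → Reachable E (u , x) (u , flipAt x d)
  reachable-flipAt conn u x d with surjective C d
  ... | v , refl = reachable-trans (reachable-layer x (conn u v))
                     (reachable-trans (subst (Reachable E (v , x)) (r-fromℕ v x) (reachable-step (fromℕ n) (v , x)))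
                       (reachable-layer (flipAt x (col C v)) (conn v u)))

  colourCoded-connected : Connected M → Connected E
  colourCoded-connected conn (u , x) (v , y) = reachable-trans
    (flipAt-closure-total (λ x y → Reachable E (u , x) (u , y))
      reachable-refl reachable-trans (reachable-flipAt conn u) x y)
    (reachable-layer y (conn u v))

  colourCoded-invol : (∀ i u → r M i (r M i u) ≡ u) → ∀ i p → r E i (r E i p) ≡ p
  colourCoded-invol invol i (u , x) with view i
  ... | ‵inject₁ j = begin
    r E (inject₁ j) (r E (inject₁ j) (u , x))   ≡⟨ cong (r E (inject₁ j)) (r-inject₁ j u x) ⟩
    r E (inject₁ j) (r M j u , x)               ≡⟨ r-inject₁ j (r M j u) x ⟩
    (r M j (r M j u) , x)                       ≡⟨ cong (_, x) (invol j u) ⟩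
    (u , x)                                     ∎
    where open ≡-Reasoning
  ... | ‵fromℕ = begin
    r E (fromℕ n) (r E (fromℕ n) (u , x))       ≡⟨ cong (r E (fromℕ n)) (r-fromℕ u x) ⟩
    r E (fromℕ n) (u , flipAt x (col C u))      ≡⟨ r-fromℕ u _ ⟩
    (u , flipAt (flipAt x (col C u)) (col C u)) ≡⟨ cong (u ,_) (flipAt-involutive x (col C u)) ⟩
    (u , x)                                     ∎
    where open ≡-Reasoning

  colourCoded-noLoop : (∀ i u → r M i u ≢ u) → ∀ i p → r E i p ≢ p
  colourCoded-noLoop noLoop i (u , x) eq with view i
  ... | ‵inject₁ j = noLoop j u (cong proj₁ (trans (sym (r-inject₁ j u x)) eq))
  ... | ‵fromℕ     = flipAt-≢ x (col C u) (cong proj₂ (trans (sym (r-fromℕ u x)) eq))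

  colourCoded-simple : (∀ i u → r M i u ≢ u) → (∀ i j u → i ≢ j → r M i u ≢ r M j u)
                     → ∀ i i′ p → i ≢ i′ → r E i p ≢ r E i′ p
  colourCoded-simple noLoop simple i i′ (u , x) i≢i′ eq with view i | view i′
  ... | ‵inject₁ j | ‵inject₁ j′ = simple j j′ u (i≢i′ ∘ cong inject₁)
                                     (cong proj₁ (trans (sym (r-inject₁ j u x)) (trans eq (r-inject₁ j′ u x))))
  ... | ‵inject₁ j | ‵fromℕ      = noLoop j u
                                     (cong proj₁ (trans (sym (r-inject₁ j u x)) (trans eq (r-fromℕ u x))))
  ... | ‵fromℕ     | ‵inject₁ j  = noLoop j u
                                     (cong proj₁ (trans (sym (r-inject₁ j u x)) (trans (sym eq) (r-fromℕ u x))))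
  ... | ‵fromℕ     | ‵fromℕ      = i≢i′ refl

  -- For j < n-1 a j-edge stays inside its facet, so both of its ends flip the same coordinate.
  r-inject₁-fromℕ-comm : ∀ j u x → suc (toℕ j) < n
                       → r E (inject₁ j) (r E (fromℕ n) (u , x)) ≡ r E (fromℕ n) (r E (inject₁ j) (u , x))
  r-inject₁-fromℕ-comm j u x j+1<n = begin
    r E (inject₁ j) (r E (fromℕ n) (u , x))       ≡⟨ cong (r E (inject₁ j)) (r-fromℕ u x) ⟩
    r E (inject₁ j) (u , flipAt x (col C u))      ≡⟨ r-inject₁ j u _ ⟩
    (r M j u , flipAt x (col C u))                ≡⟨ cong (λ d → r M j u , flipAt x d) (onFacets C j u j+1<n) ⟨
    (r M j u , flipAt x (col C (r M j u)))        ≡⟨ r-fromℕ (r M j u) x ⟨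
    r E (fromℕ n) (r M j u , x)                   ≡⟨ cong (r E (fromℕ n)) (r-inject₁ j u x) ⟨
    r E (fromℕ n) (r E (inject₁ j) (u , x))       ∎
    where open ≡-Reasoning

  colourCoded-fourCycle : (∀ i j u → Far i j → r M i (r M j u) ≡ r M j (r M i u))
                        → ∀ i i′ p → Far i i′ → r E i (r E i′ p) ≡ r E i′ (r E i p)
  colourCoded-fourCycle fourCycle i i′ (u , x) far with view i | view i′
  ... | ‵inject₁ j | ‵inject₁ j′ = begin
    r E (inject₁ j) (r E (inject₁ j′) (u , x)) ≡⟨ cong (r E (inject₁ j)) (r-inject₁ j′ u x) ⟩
    r E (inject₁ j) (r M j′ u , x)             ≡⟨ r-inject₁ j (r M j′ u) x ⟩
    (r M j (r M j′ u) , x)                     ≡⟨ cong (_, x) (fourCycle j j′ u (Far-inject₁ j j′ far)) ⟩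
    (r M j′ (r M j u) , x)                     ≡⟨ r-inject₁ j′ (r M j u) x ⟨
    r E (inject₁ j′) (r M j u , x)             ≡⟨ cong (r E (inject₁ j′)) (r-inject₁ j u x) ⟨
    r E (inject₁ j′) (r E (inject₁ j) (u , x)) ∎
    where open ≡-Reasoning
  ... | ‵inject₁ j | ‵fromℕ     = r-inject₁-fromℕ-comm j u x (Far-inject₁-fromℕ j far)
  ... | ‵fromℕ     | ‵inject₁ j = sym (r-inject₁-fromℕ-comm j u x (Far-inject₁-fromℕ j (swap far)))
  ... | ‵fromℕ     | ‵fromℕ     = contradiction far (¬Far-refl (fromℕ n))

  colourCoded-isManiplex : IsManiplex M → IsManiplex E
  colourCoded-isManiplex MM = record
    { invol     = colourCoded-invol invol
    ; noLoop    = colourCoded-noLoop noLoop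
    ; simple    = colourCoded-simple noLoop simple
    ; fourCycle = colourCoded-fourCycle fourCycle
    ; connected = colourCoded-connected connected
    }
    where open IsManiplex MM

  colourCoded-bipartite : Bipartite E → Bipartite M
  colourCoded-bipartite (c , alternates) = (λ u → c (u , x₀)) ,
    λ j u → trans (cong c (sym (r-inject₁ j u x₀))) (alternates (inject₁ j) (u , x₀))
    where x₀ = replicate ℓ false

  liftAutomorphism : (φ : Automorphism M) (T : Vec Bool ℓ ↔ Vec Bool ℓ)
                   → (∀ u x → to T (flipAt x (col C u)) ≡ flipAt (to T x) (col C (act φ u)))
                   → Automorphism E
  liftAutomorphism φ T T-flipAt = record
    { bij      = mk↔ₛ′ φ×T (Product.map (from φ↔) (from T))
                   (λ (u , x) → cong₂ _,_ (strictlyInverseˡ φ↔ u) (strictlyInverseˡ T x))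
                   (λ (u , x) → cong₂ _,_ (strictlyInverseʳ φ↔ u) (strictlyInverseʳ T x))
    ; preserve = preserve′
    }
    where
    φ↔ = Automorphism.bij φ
    φ×T = Product.map (act φ) (to T)
    preserve′ : ∀ i p → φ×T (r E i p) ≡ r E i (φ×T p)
    preserve′ i (u , x) with view i
    ... | ‵inject₁ j = begin
      φ×T (r E (inject₁ j) (u , x))           ≡⟨ cong φ×T (r-inject₁ j u x) ⟩
      (act φ (r M j u) , to T x)              ≡⟨ cong (_, to T x) (Automorphism.preserve φ j u) ⟩
      (r M j (act φ u) , to T x)              ≡⟨ r-inject₁ j (act φ u) (to T x) ⟨
      r E (inject₁ j) (act φ u , to T x)      ∎
      where open ≡-Reasoning
    ... | ‵fromℕ = begin
      φ×T (r E (fromℕ n) (u , x))             ≡⟨ cong φ×T (r-fromℕ u x) ⟩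
      (act φ u , to T (flipAt x (col C u)))   ≡⟨ cong (act φ u ,_) (T-flipAt u x) ⟩
      (act φ u , flipAt (to T x) (col C (act φ u))) ≡⟨ r-fromℕ (act φ u) (to T x) ⟨
      r E (fromℕ n) (act φ u , to T x)        ∎
      where open ≡-Reasoning

  module _ (invariant : AutInvariant M C) where

    affine-flipAt-col : ∀ φ z u x → to (affine (proj₁ (invariant φ)) z) (flipAt x (col C u))
                                  ≡ flipAt (to (affine (proj₁ (invariant φ)) z) x) (col C (act φ u))
    affine-flipAt-col φ z u x =
      trans (affine-flipAt π z x (col C u)) (cong (flipAt (to (affine π z) x)) (sym (proj₂ (invariant φ) u)))
      where π = proj₁ (invariant φ)

    affineLift : Automorphism M → Vec Bool ℓ → Automorphism E
    affineLift φ z = liftAutomorphism φ (affine (proj₁ (invariant φ)) z) (affine-flipAt-col φ z)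

    affineLift-transitive : Regular M → ∀ p q
                          → Σ (Automorphism M) λ φ → Σ (Vec Bool ℓ) λ z → act (affineLift φ z) p ≡ q
    affineLift-transitive regular (u , x) (v , y) =
      let (φ , φu≡v) = regular u v
          (z , πx+z≡y) = affine-transitive (proj₁ (invariant φ)) x y
      in φ , z , cong₂ _,_ φu≡v πx+z≡y

    colourCoded-regular : Regular M → Regular E
    colourCoded-regular regular p q =
      let (φ , z , eq) = affineLift-transitive regular p q in affineLift φ z , eq

    affineLift-complete : Connected M → Regular M → Flag M → (ψ : Automorphism E)
                        → Σ (Automorphism M) λ φ → Σ (Vec Bool ℓ) λ z → ∀ p → act ψ p ≡ act (affineLift φ z) p
    affineLift-complete conn regular u ψ =
      let p = (u , replicate ℓ false)
          (φ , z , eq) = affineLift-transitive regular p (act ψ p)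
      in φ , z , homomorphisms-agree {B = E} (colourCoded-connected conn)
                   (Automorphism.preserve ψ) (Automorphism.preserve (affineLift φ z)) (sym eq)

-- Cross-covers of colour-coded extensions

OddClosedWalkOfEvenWeight : ∀ {k} .{{_ : NonZero k}} (M : Pregraph n) → (Fin n → Flag M → Fin k) → Set
OddClosedWalkOfEvenWeight {n} M ω = Σ (Flag M) λ u → Σ (List (Fin n)) λ W →
  (walkEnd M u W ≡ u) × (length W % 2 ≡ 1) × EvenZ (walkWeight M ω u W)

Lifts-resp-≗ : ∀ {k} .{{_ : NonZero k}} {M : Pregraph n} {ω : Fin n → Flag M → Fin k} {φ φ′ : Automorphism M}
             → (∀ u → act φ u ≡ act φ′ u) → Lifts M ω φ → Lifts M ω φ′
Lifts-resp-≗ φ≗φ′ (ψ , over) = ψ , λ y → trans (over y) (φ≗φ′ (proj₁ y))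

module _ {k} .{{_ : NonZero k}} (M : Pregraph n) (ω : Fin n → Flag M → Fin k) (C : Colouring M ℓ) where

  private
    E  = colourCoded M C
    ωᴱ = colourCodedWeight M C ω

  walkWeight-layer : ∀ u x w → walkWeight E ωᴱ (u , x) (map inject₁ w) ≡ sign (evenᵇ x) (walkWeight M ω u w)
  walkWeight-layer u x []      = sym (sign-0ₖ (evenᵇ x))
  walkWeight-layer u x (j ∷ w) = begin
    ωᴱ (inject₁ j) (u , x) -ₖ walkWeight E ωᴱ (r E (inject₁ j) (u , x)) (map inject₁ w)
      ≡⟨ cong₂ _-ₖ_ (snoc-inject₁ _ 0ₖ j)
                    (cong (λ p → walkWeight E ωᴱ p (map inject₁ w)) (r-inject₁ M C j u x)) ⟩
    sign (evenᵇ x) (ω j u) -ₖ walkWeight E ωᴱ (r M j u , x) (map inject₁ w)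
      ≡⟨ cong (_-ₖ_ (sign (evenᵇ x) (ω j u))) (walkWeight-layer (r M j u) x w) ⟩
    sign (evenᵇ x) (ω j u) -ₖ sign (evenᵇ x) (walkWeight M ω (r M j u) w)
      ≡⟨ sign-distrib-ₖ (evenᵇ x) (ω j u) _ ⟨
    sign (evenᵇ x) (ω j u -ₖ walkWeight M ω (r M j u) w)
      ∎
    where open ≡-Reasoning

  colourCoded-oddClosedWalkOfEvenWeight : OddClosedWalkOfEvenWeight M ω → OddClosedWalkOfEvenWeight E ωᴱ
  colourCoded-oddClosedWalkOfEvenWeight (u , W , closed , odd , even) =
    (u , x₀) , map inject₁ W ,
    trans (walkEnd-layer M C u x₀ W) (cong (_, x₀) closed) ,
    trans (cong (_% 2) (length-map inject₁ W)) odd ,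
    subst EvenZ (sym same-weight) even
    where
    x₀ = replicate ℓ false
    same-weight : walkWeight E ωᴱ (u , x₀) (map inject₁ W) ≡ walkWeight M ω u W
    same-weight = trans (walkWeight-layer u x₀ W)
                        (cong (λ e → sign e (walkWeight M ω u W)) (evenᵇ-replicate-false {ℓ}))

  coverColouring : Colouring (crossCover M ω) ℓ
  coverColouring = record
    { col        = col C ∘ proj₁
    ; onFacets   = λ i y → onFacets C i (proj₁ y)
    ; surjective = λ c → let (u , eq) = surjective C c in (u , 0ₖ) , eq
    }

  crossCover-colourCoded : Isomorphism (colourCoded (crossCover M ω) coverColouring) (crossCover E ωᴱ)
  crossCover-colourCoded = record
    { bij         = mk↔ₛ′ f g
                      (λ ((u , x) , a) → cong (λ a → (u , x) , a) (sign-involutive (evenᵇ x) a))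
                      (λ ((u , a) , x) → cong (λ a → (u , a) , x) (sign-involutive (evenᵇ x) a))
    ; homomorphic = f-homomorphic
    }
    where
    A = colourCoded (crossCover M ω) coverColouring
    f : Flag A → Flag (crossCover E ωᴱ)
    f q = (proj₁ (proj₁ q) , proj₂ q) , sign (evenᵇ (proj₂ q)) (proj₂ (proj₁ q))
    g : Flag (crossCover E ωᴱ) → Flag A
    g q = (proj₁ (proj₁ q) , sign (evenᵇ (proj₂ (proj₁ q))) (proj₂ q)) , proj₂ (proj₁ q)
    f-homomorphic : IsHomomorphism A (crossCover E ωᴱ) f
    f-homomorphic i ((u , a) , x) with view i
    ... | ‵inject₁ j = begin
      f (r A (inject₁ j) ((u , a) , x))
        ≡⟨ cong f (r-inject₁ (crossCover M ω) coverColouring j (u , a) x) ⟩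
      ((r M j u , x) , sign (evenᵇ x) (ω j u -ₖ a))
        ≡⟨ cong₂ _,_ (r-inject₁ M C j u x) (sym (sign-distrib-ₖ (evenᵇ x) (ω j u) a)) ⟨
      (r E (inject₁ j) (u , x) , sign (evenᵇ x) (ω j u) -ₖ sign (evenᵇ x) a)
        ≡⟨ cong (λ w → r E (inject₁ j) (u , x) , w -ₖ sign (evenᵇ x) a) (snoc-inject₁ _ 0ₖ j) ⟨
      r (crossCover E ωᴱ) (inject₁ j) (f ((u , a) , x))
        ∎
      where open ≡-Reasoning
    ... | ‵fromℕ = begin
      f (r A (fromℕ n) ((u , a) , x))
        ≡⟨ cong f (r-fromℕ (crossCover M ω) coverColouring (u , a) x) ⟩
      ((u , flipAt x (col C u)) , sign (evenᵇ (flipAt x (col C u))) a)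
        ≡⟨ cong (λ e → (u , flipAt x (col C u)) , sign e a) (evenᵇ-flipAt x (col C u)) ⟩
      ((u , flipAt x (col C u)) , sign (not (evenᵇ x)) a)
        ≡⟨ cong₂ _,_ (r-fromℕ M C u x) (sym (sign-not (evenᵇ x) a)) ⟨
      (r E (fromℕ n) (u , x) , 0ₖ -ₖ sign (evenᵇ x) a)
        ≡⟨ cong (λ w → r E (fromℕ n) (u , x) , w -ₖ sign (evenᵇ x) a) (snoc-fromℕ {n} _ 0ₖ) ⟨
      r (crossCover E ωᴱ) (fromℕ n) (f ((u , a) , x))
        ∎
      where open ≡-Reasoning

  liftAutomorphism-lifts : ∀ φ T T-flipAt → Lifts M ω φ → Lifts E ωᴱ (liftAutomorphism M C φ T T-flipAt)
  liftAutomorphism-lifts φ T T-flipAt (φ̃ , φ̃-over-φ) =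
    conjugate crossCover-colourCoded Φ̃ ,
    λ ((u , x) , a) → cong (_, to T x) (φ̃-over-φ (u , sign (evenᵇ x) a))
    where
    Φ̃ = liftAutomorphism (crossCover M ω) coverColouring φ̃ T λ w x →
          trans (T-flipAt (proj₁ w) x) (cong (flipAt (to T x) ∘ col C) (sym (φ̃-over-φ w)))

  colourCoded-consistent : Connected M → Regular M → AutInvariant M C → Flag M
                         → Consistent M ω → Consistent E ωᴱ
  colourCoded-consistent conn regular invariant u consistent ψ
    with affineLift-complete M C invariant conn regular u ψ
  ... | φ , z , ψ≗φ̂ = Lifts-resp-≗ {φ = affineLift M C invariant φ z} {φ′ = ψ} (sym ∘ ψ≗φ̂)
          (liftAutomorphism-lifts φ (affine (proj₁ (invariant φ)) z) (affine-flipAt-col M C invariant φ z)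
            (consistent φ))

lemma5p7 : (n k ℓ : ℕ) .{{_ : NonZero k}} (M : Pregraph n)
           (ω : Fin n → Flag M → Fin k)
           → IsWeight M ω → ProperPair M ω
           → (C : Colouring M ℓ) → AutInvariant M C
           → ProperPair (colourCoded M C) (colourCodedWeight M C ω)
lemma5p7 n k ℓ M ω _ proper C invariant = record
  { maniplex       = colourCoded-isManiplex M C maniplex
  ; regular        = colourCoded-regular M C invariant regular
  ; oddEvenWalk    = colourCoded-oddClosedWalkOfEvenWeight M ω C oddEvenWalk
  ; coverManiplex  = isManiplex-transport iso (colourCoded-isManiplex (crossCover M ω) C̃ coverManiplex)
  ; coverNonOrient = coverNonOrient ∘ colourCoded-bipartite (crossCover M ω) C̃ ∘ bipartite-reflect iso
  ; consistent     = colourCoded-consistent M ω C (IsManiplex.connected maniplex) regular invariant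
                       someFlag consistent
  }
  where
  open ProperPair proper
  C̃ = coverColouring M ω C
  iso = crossCover-colourCoded M ω C
  someFlag = proj₁ oddEvenWalk
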